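{- Let $\mathcal{C}$ be a cartesian closed category with an adjunction of endofunctors $\Diamond\dashv\Box$ in which $\Box$ is an idempotent comonad, and let $(\Diamond,\eta,\mu)$ be the induced monad. For all contexts $\Gamma_1,\Gamma_2,\Gamma_3,\Gamma_4$ (with $\Gamma_1,\Gamma_2,\Gamma_3,\Gamma_4$ well formed), \[ (l_{\Gamma_2,\Gamma_3,\Gamma_4})_{[\![\Gamma_1]\!]} \;=\; (l_{\Gamma_2,\bullet,\Gamma_4})_{[\![\Gamma_1]\!]}\circ[\![\Gamma_4]\!]\big((l_{\Gamma_3})_{[\![\Gamma_1,\Gamma_2]\!]}\big) \] as arrows $[\![\Gamma_1,\Gamma_2,\Gamma_3,\Gamma_4]\!]\to\Diamond[\![\Gamma_1]\!]$.
   Context: Contexts: $\Gamma ::= \cdot \mid \Gamma,x:A \mid \Gamma,\bullet$, where $A$ ranges over types (built from atoms by $1,\times,\to,\Box$) and $\bullet$ is a structural symbol called a lock. Fix an interpretation $[\![A]\!]$ of types as objects of $\mathcal{C}$ (atoms arbitrary, the rest via the cartesian closed structure and $\Box$). Each context $\Gamma$ denotes an endofunctor $[\![\Gamma]\!]$ of $\mathcal{C}$: $[\![\cdot]\!]=\mathrm{Id}$, $[\![\Gamma,x:A]\!](X)=[\![\Gamma]\!](X)\times[\![A]\!]$, $[\![\Gamma,\bullet]\!](X)=\Diamond([\![\Gamma]\!](X))$; and as an object, $[\![\Gamma]\!]$ means $[\![\Gamma]\!](1)$, so that $[\![\Gamma,\Gamma']\!]=[\![\Gamma']\!]([\![\Gamma]\!])$.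 The monad $(\Diamond,\eta,\mu)$ is the one induced on the left adjoint by the comonad structure of $\Box$; idempotence means every $\mu_X:\Diamond\Diamond X\to\Diamond X$ is an isomorphism with inverse $\eta_{\Diamond X}=\Diamond\eta_X$. Lock replacement natural transformations $l_\Gamma:[\![\Gamma]\!]\Rightarrow\Diamond$ are defined by: $l_{\cdot}=\eta$; $(l_{\Gamma,x:A})_X=(l_\Gamma)_X\circ\mathrm{pr}$ where $\mathrm{pr}:[\![\Gamma]\!](X)\times[\![A]\!]\to[\![\Gamma]\!](X)$; $(l_{\Gamma,\bullet})_X=\mu_X\circ\Diamond((l_\Gamma)_X)$. -}

module Defs where

open import Level using (Level; _⊔_) renaming (suc to lsuc)
open import Data.Nat using (ℕ)
open import Data.List using (List; []; _∷_)
open import Data.List.Relation.Unary.Unique.Propositional using (Unique)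
open import Relation.Binary.PropositionalEquality using (_≡_; refl; cong)
open import Relation.Binary.Structures using (IsEquivalence)

record Category (o ℓ e : Level) : Set (lsuc (o ⊔ ℓ ⊔ e)) where
  infixr 9 _∘_
  infix  4 _≈_
  infixr 4 _⇒_
  field
    Obj       : Set o
    _⇒_       : Obj → Obj → Set ℓ
    _≈_       : ∀ {A B} → (A ⇒ B) → (A ⇒ B) → Set e
    id        : ∀ {A} → A ⇒ A
    _∘_       : ∀ {A B C} → (B ⇒ C) → (A ⇒ B) → (A ⇒ C)
    assoc     : ∀ {A B C D} {f : A ⇒ B} {g : B ⇒ C} {h : C ⇒ D} →
                (h ∘ g) ∘ f ≈ h ∘ (g ∘ f)
    identityˡ : ∀ {A B} {f : A ⇒ B} → id ∘ f ≈ f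
    identityʳ : ∀ {A B} {f : A ⇒ B} → f ∘ id ≈ f
    equiv     : ∀ {A B} → IsEquivalence (_≈_ {A} {B})
    ∘-resp-≈  : ∀ {A B C} {f h : B ⇒ C} {g i : A ⇒ B} →
                f ≈ h → g ≈ i → f ∘ g ≈ h ∘ i

record Endofunctor {o ℓ e : Level} (C : Category o ℓ e) : Set (o ⊔ ℓ ⊔ e) where
  open Category C
  field
    F₀           : Obj → Obj
    F₁           : ∀ {A B} → A ⇒ B → F₀ A ⇒ F₀ B
    identity     : ∀ {A} → F₁ (id {A}) ≈ id
    homomorphism : ∀ {A B C} {f : A ⇒ B} {g : B ⇒ C} →
                   F₁ (g ∘ f) ≈ F₁ g ∘ F₁ f
    F-resp-≈     : ∀ {A B} {f g : A ⇒ B} → f ≈ g → F₁ f ≈ F₁ g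

record CartesianClosed {o ℓ e : Level} (C : Category o ℓ e) : Set (o ⊔ ℓ ⊔ e) where
  open Category C
  infixr 7 _×_
  infixr 5 _⇨_
  field
    ⊤        : Obj
    !        : ∀ {A} → A ⇒ ⊤
    !-unique : ∀ {A} (f : A ⇒ ⊤) → ! ≈ f
    _×_      : Obj → Obj → Obj
    π₁       : ∀ {A B} → A × B ⇒ A
    π₂       : ∀ {A B} → A × B ⇒ B
    ⟨_,_⟩    : ∀ {A B X} → X ⇒ A → X ⇒ B → X ⇒ A × B
    project₁ : ∀ {A B X} {f : X ⇒ A} {g : X ⇒ B} → π₁ ∘ ⟨ f , g ⟩ ≈ f
    project₂ : ∀ {A B X} {f : X ⇒ A} {g : X ⇒ B} → π₂ ∘ ⟨ f , g ⟩ ≈ g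
    ⟨⟩-unique : ∀ {A B X} {h : X ⇒ A × B} {f : X ⇒ A} {g : X ⇒ B} →
                π₁ ∘ h ≈ f → π₂ ∘ h ≈ g → ⟨ f , g ⟩ ≈ h
    _⇨_      : Obj → Obj → Obj
    eval     : ∀ {A B} → (A ⇨ B) × A ⇒ B
    curry    : ∀ {A B X} → X × A ⇒ B → X ⇒ (A ⇨ B)
    β        : ∀ {A B X} {f : X × A ⇒ B} →
               eval ∘ ⟨ curry f ∘ π₁ , π₂ ⟩ ≈ f
    curry-unique : ∀ {A B X} {f : X × A ⇒ B} {g : X ⇒ (A ⇨ B)} →
               eval ∘ ⟨ g ∘ π₁ , π₂ ⟩ ≈ f → curry f ≈ g

record Setting (o ℓ e : Level) : Set (lsuc (o ⊔ ℓ ⊔ e)) where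
  field
    C   : Category o ℓ e
    ccc : CartesianClosed C
    ◇   : Endofunctor C
    □   : Endofunctor C
  open Category C
  open Endofunctor ◇ renaming (F₀ to ◇₀; F₁ to ◇₁)
  open Endofunctor □ renaming (F₀ to □₀; F₁ to □₁)
  field
    unit       : ∀ X → X ⇒ □₀ (◇₀ X)
    counit     : ∀ X → ◇₀ (□₀ X) ⇒ X
    unit-nat   : ∀ {X Y} (f : X ⇒ Y) → unit Y ∘ f ≈ □₁ (◇₁ f) ∘ unit X
    counit-nat : ∀ {X Y} (f : X ⇒ Y) → counit Y ∘ ◇₁ (□₁ f) ≈ f ∘ counit X
    zig        : ∀ X → counit (◇₀ X) ∘ ◇₁ (unit X) ≈ id
    zag        : ∀ X → □₁ (counit X) ∘ unit (□₀ X) ≈ id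
    ε          : ∀ X → □₀ X ⇒ X
    δ          : ∀ X → □₀ X ⇒ □₀ (□₀ X)
    ε-nat      : ∀ {X Y} (f : X ⇒ Y) → ε Y ∘ □₁ f ≈ f ∘ ε X
    δ-nat      : ∀ {X Y} (f : X ⇒ Y) → δ Y ∘ □₁ f ≈ □₁ (□₁ f) ∘ δ X
    identityˡ-cm : ∀ X → ε (□₀ X) ∘ δ X ≈ id
    identityʳ-cm : ∀ X → □₁ (ε X) ∘ δ X ≈ id
    assoc-cm   : ∀ X → δ (□₀ X) ∘ δ X ≈ □₁ (δ X) ∘ δ X
    -- idempotence: every δ X is an isomorphism
    δ⁻¹        : ∀ X → □₀ (□₀ X) ⇒ □₀ X
    δ⁻¹∘δ      : ∀ X → δ⁻¹ X ∘ δ X ≈ id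
    δ∘δ⁻¹      : ∀ X → δ X ∘ δ⁻¹ X ≈ id

data Ty : Set where
  atom : ℕ → Ty
  𝟙    : Ty
  _⊗_  : Ty → Ty → Ty
  _⟶_  : Ty → Ty → Ty
  ■    : Ty → Ty

infixl 5 _,_∶_ _,•
data Ctx : Set where
  ∅     : Ctx
  _,_∶_ : Ctx → ℕ → Ty → Ctx
  _,•   : Ctx → Ctx

infixl 4 _++_
_++_ : Ctx → Ctx → Ctx
Γ ++ ∅         = Γ
Γ ++ (Δ , x ∶ A) = (Γ ++ Δ) , x ∶ A
Γ ++ (Δ ,•)    = (Γ ++ Δ) ,•

names : Ctx → List ℕ
names ∅           = []
names (Γ , x ∶ A) = x ∷ names Γ
names (Γ ,•)      = names Γ

WellFormed : Ctx → Set
WellFormed Γ = Unique (names Γ)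

module Interp {o ℓ e : Level} (S : Setting o ℓ e)
              (⟦atom⟧ : ℕ → Category.Obj (Setting.C S)) where
  open Setting S
  open Category C
  open CartesianClosed ccc
  open Endofunctor ◇ renaming (F₀ to ◇₀; F₁ to ◇₁)
  open Endofunctor □ renaming (F₀ to □₀; F₁ to □₁)

  ⟦_⟧ty : Ty → Obj
  ⟦ atom n ⟧ty = ⟦atom⟧ n
  ⟦ 𝟙 ⟧ty      = ⊤
  ⟦ A ⊗ B ⟧ty  = ⟦ A ⟧ty × ⟦ B ⟧ty
  ⟦ A ⟶ B ⟧ty  = ⟦ A ⟧ty ⇨ ⟦ B ⟧ty
  ⟦ ■ A ⟧ty    = □₀ ⟦ A ⟧ty

  η : ∀ X → X ⇒ ◇₀ X
  η X = ε (◇₀ X) ∘ unit X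

  μ : ∀ X → ◇₀ (◇₀ X) ⇒ ◇₀ X
  μ X = counit (◇₀ X) ∘ ◇₁ (counit (□₀ (◇₀ X)) ∘ ◇₁ (δ (◇₀ X) ∘ unit X))

  -- contexts as endofunctors
  ⟦_⟧₀ : Ctx → Obj → Obj
  ⟦ ∅ ⟧₀ X         = X
  ⟦ Γ , x ∶ A ⟧₀ X = ⟦ Γ ⟧₀ X × ⟦ A ⟧ty
  ⟦ Γ ,• ⟧₀ X      = ◇₀ (⟦ Γ ⟧₀ X)

  ⟦_⟧₁ : ∀ Γ {X Y} → X ⇒ Y → ⟦ Γ ⟧₀ X ⇒ ⟦ Γ ⟧₀ Y
  ⟦ ∅ ⟧₁ f         = f
  ⟦ Γ , x ∶ A ⟧₁ f = ⟨ ⟦ Γ ⟧₁ f ∘ π₁ , id ∘ π₂ ⟩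
  ⟦ Γ ,• ⟧₁ f      = ◇₁ (⟦ Γ ⟧₁ f)

  ⟦_⟧ : Ctx → Obj
  ⟦ Γ ⟧ = ⟦ Γ ⟧₀ ⊤

  l : ∀ Γ X → ⟦ Γ ⟧₀ X ⇒ ◇₀ X
  l ∅ X           = η X
  l (Γ , x ∶ A) X = l Γ X ∘ π₁
  l (Γ ,•) X      = μ X ∘ ◇₁ (l Γ X)

  -- ⟦Γ,Γ'⟧ = ⟦Γ'⟧(⟦Γ⟧) holds up to propositional equality of objects
  ++-⟦⟧₀ : ∀ Γ Δ X → ⟦ Γ ++ Δ ⟧₀ X ≡ ⟦ Δ ⟧₀ (⟦ Γ ⟧₀ X)
  ++-⟦⟧₀ Γ ∅ X         = refl
  ++-⟦⟧₀ Γ (Δ , x ∶ A) X = cong (_× ⟦ A ⟧ty) (++-⟦⟧₀ Γ Δ X)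
  ++-⟦⟧₀ Γ (Δ ,•) X    = cong ◇₀ (++-⟦⟧₀ Γ Δ X)

  coe : ∀ {X Y} → X ≡ Y → X ⇒ Y
  coe refl = id

module Submission where

-- Write extend f = μ ∘ ◇ f for the Kleisli extension of the monad induced by
-- ◇ ⊣ □.  Lock replacement on a concatenation factors through a lock,
-- l (Γ ++ Δ) = extend (l Γ) ∘ l Δ  (l-++), by induction on Δ from the unit and
-- associativity laws; the monad laws themselves come from the adjunction via
-- the transpose ⌊ g ⌋ = counit ∘ ◇ g.  Applying l-++ to both sides and using
-- naturality of l Γ₄, both sides become extend (l (Γ₂ ,•)) ∘ ◇ (l Γ₃) ∘ l Γ₄.

open import Level using (Level)
open import Relation.Binary.PropositionalEquality using (_≡_; refl; sym; trans; cong)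
open import Relation.Binary.Bundles using (Setoid)
import Relation.Binary.Reasoning.Setoid as SetoidReasoning
open import Data.Nat using (ℕ)
open import Defs

module LockReplacement {o ℓ e : Level} (S : Setting o ℓ e)
                       (⟦atom⟧ : ℕ → Category.Obj (Setting.C S)) where
  open Setting S
  open Category C
  open CartesianClosed ccc using (_×_; π₁; project₁)
  open Endofunctor ◇ using () renaming (F₀ to ◇₀; F₁ to ◇₁; identity to ◇-identity;
                                        homomorphism to ◇-homomorphism; F-resp-≈ to ◇-resp-≈)
  open Endofunctor □ using () renaming (F₀ to □₀; F₁ to □₁; homomorphism to □-homomorphism)
  open Interp S ⟦atom⟧

  hom-setoid : Obj → Obj → Setoid ℓ e
  hom-setoid A B = record { Carrier = A ⇒ B ; _≈_ = _≈_ ; isEquivalence = equiv }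

  module HomReasoning {A B : Obj} where
    open Setoid (hom-setoid A B) public using ()
      renaming (refl to ≈-refl; sym to ≈-sym; trans to ≈-trans)
    open SetoidReasoning (hom-setoid A B) public

  open HomReasoning

  infixr 4 _⟩∘⟨_ refl⟩∘⟨_
  infixl 5 _⟩∘⟨refl

  _⟩∘⟨_ : ∀ {A B D} {f h : B ⇒ D} {g i : A ⇒ B} → f ≈ h → g ≈ i → f ∘ g ≈ h ∘ i
  _⟩∘⟨_ = ∘-resp-≈

  refl⟩∘⟨_ : ∀ {A B D} {f : B ⇒ D} {g i : A ⇒ B} → g ≈ i → f ∘ g ≈ f ∘ i
  refl⟩∘⟨ p = ≈-refl ⟩∘⟨ p

  _⟩∘⟨refl : ∀ {A B D} {f h : B ⇒ D} {g : A ⇒ B} → f ≈ h → f ∘ g ≈ h ∘ g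
  p ⟩∘⟨refl = p ⟩∘⟨ ≈-refl

  sym-assoc : ∀ {A B D E} {f : A ⇒ B} {g : B ⇒ D} {h : D ⇒ E} → h ∘ g ∘ f ≈ (h ∘ g) ∘ f
  sym-assoc = ≈-sym assoc

  pullˡ : ∀ {A B D E} {f : A ⇒ B} {g : B ⇒ D} {h : D ⇒ E} {k : B ⇒ E} →
          h ∘ g ≈ k → h ∘ g ∘ f ≈ k ∘ f
  pullˡ p = ≈-trans sym-assoc (p ⟩∘⟨refl)

  pushˡ : ∀ {A B D E} {f : A ⇒ B} {g : B ⇒ D} {h : D ⇒ E} {k : B ⇒ E} →
          k ≈ h ∘ g → k ∘ f ≈ h ∘ g ∘ f
  pushˡ p = ≈-trans (p ⟩∘⟨refl) assoc

  square-∘ʳ : ∀ {A B D E F} {f : A ⇒ B} {g : B ⇒ D} {h : D ⇒ F} {j : B ⇒ E} {k : E ⇒ F} →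
              h ∘ g ≈ k ∘ j → h ∘ g ∘ f ≈ k ∘ j ∘ f
  square-∘ʳ p = ≈-trans (pullˡ p) assoc

  cancelˡ : ∀ {A B D} {f : A ⇒ B} {g : B ⇒ D} {h : D ⇒ B} → h ∘ g ≈ id → h ∘ g ∘ f ≈ f
  cancelˡ p = ≈-trans (pullˡ p) identityˡ

  ⌊_⌋ : ∀ {X Y} → X ⇒ □₀ Y → ◇₀ X ⇒ Y
  ⌊ g ⌋ = counit _ ∘ ◇₁ g

  ⌊⌋-resp-≈ : ∀ {X Y} {g h : X ⇒ □₀ Y} → g ≈ h → ⌊ g ⌋ ≈ ⌊ h ⌋
  ⌊⌋-resp-≈ p = refl⟩∘⟨ ◇-resp-≈ p

  ⌊⌋-natˡ : ∀ {W X Y} (g : X ⇒ □₀ Y) (f : W ⇒ X) → ⌊ g ⌋ ∘ ◇₁ f ≈ ⌊ g ∘ f ⌋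
  ⌊⌋-natˡ g f = ≈-trans assoc (refl⟩∘⟨ ≈-sym ◇-homomorphism)

  ⌊⌋-natʳ : ∀ {X Y Z} (g : Y ⇒ Z) (h : X ⇒ □₀ Y) → ⌊ □₁ g ∘ h ⌋ ≈ g ∘ ⌊ h ⌋
  ⌊⌋-natʳ g h = begin
    counit _ ∘ ◇₁ (□₁ g ∘ h)        ≈⟨ refl⟩∘⟨ ◇-homomorphism ⟩
    counit _ ∘ ◇₁ (□₁ g) ∘ ◇₁ h     ≈⟨ pullˡ (counit-nat g) ⟩
    (g ∘ counit _) ∘ ◇₁ h           ≈⟨ assoc ⟩
    g ∘ ⌊ h ⌋                        ∎

  □⌊⌋∘unit : ∀ {X Y} (g : X ⇒ □₀ Y) → □₁ ⌊ g ⌋ ∘ unit X ≈ g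
  □⌊⌋∘unit g = begin
    □₁ (counit _ ∘ ◇₁ g) ∘ unit _      ≈⟨ pushˡ □-homomorphism ⟩
    □₁ (counit _) ∘ □₁ (◇₁ g) ∘ unit _ ≈˘⟨ refl⟩∘⟨ unit-nat g ⟩
    □₁ (counit _) ∘ unit _ ∘ g         ≈⟨ cancelˡ (zag _) ⟩
    g                                  ∎

  η-natural : ∀ {X Y} (f : X ⇒ Y) → η Y ∘ f ≈ ◇₁ f ∘ η X
  η-natural f = begin
    (ε _ ∘ unit _) ∘ f         ≈⟨ assoc ⟩
    ε _ ∘ unit _ ∘ f           ≈⟨ refl⟩∘⟨ unit-nat f ⟩
    ε _ ∘ □₁ (◇₁ f) ∘ unit _   ≈⟨ pullˡ (ε-nat (◇₁ f)) ⟩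
    (◇₁ f ∘ ε _) ∘ unit _      ≈⟨ assoc ⟩
    ◇₁ f ∘ η _                 ∎

  ⌊⌋∘η : ∀ {X Y} (g : X ⇒ □₀ Y) → ⌊ g ⌋ ∘ η X ≈ ε Y ∘ g
  ⌊⌋∘η g = begin
    ⌊ g ⌋ ∘ ε _ ∘ unit _        ≈⟨ pullˡ (≈-sym (ε-nat ⌊ g ⌋)) ⟩
    (ε _ ∘ □₁ ⌊ g ⌋) ∘ unit _   ≈⟨ assoc ⟩
    ε _ ∘ □₁ ⌊ g ⌋ ∘ unit _     ≈⟨ refl⟩∘⟨ □⌊⌋∘unit g ⟩
    ε _ ∘ g                     ∎

  -- μ X is definitionally ⌊ δ♭ X ⌋.
  δ♭ : ∀ X → ◇₀ X ⇒ □₀ (◇₀ X)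
  δ♭ X = ⌊ δ (◇₀ X) ∘ unit X ⌋

  δ♭-natural : ∀ {X Y} (f : X ⇒ Y) → δ♭ Y ∘ ◇₁ f ≈ □₁ (◇₁ f) ∘ δ♭ X
  δ♭-natural f = begin
    δ♭ _ ∘ ◇₁ f                          ≈⟨ ⌊⌋-natˡ _ f ⟩
    ⌊ (δ _ ∘ unit _) ∘ f ⌋               ≈⟨ ⌊⌋-resp-≈ unit-step ⟩
    ⌊ □₁ (□₁ (◇₁ f)) ∘ δ _ ∘ unit _ ⌋    ≈⟨ ⌊⌋-natʳ (□₁ (◇₁ f)) _ ⟩
    □₁ (◇₁ f) ∘ δ♭ _                     ∎
    where
    unit-step : (δ _ ∘ unit _) ∘ f ≈ □₁ (□₁ (◇₁ f)) ∘ δ _ ∘ unit _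
    unit-step = begin
      (δ _ ∘ unit _) ∘ f                ≈⟨ assoc ⟩
      δ _ ∘ unit _ ∘ f                  ≈⟨ refl⟩∘⟨ unit-nat f ⟩
      δ _ ∘ □₁ (◇₁ f) ∘ unit _          ≈⟨ pullˡ (δ-nat (◇₁ f)) ⟩
      (□₁ (□₁ (◇₁ f)) ∘ δ _) ∘ unit _   ≈⟨ assoc ⟩
      □₁ (□₁ (◇₁ f)) ∘ δ _ ∘ unit _     ∎

  □⌊⌋∘δ♭ : ∀ {X Y} (g : X ⇒ □₀ Y) → □₁ ⌊ g ⌋ ∘ δ♭ X ≈ ⌊ δ Y ∘ g ⌋
  □⌊⌋∘δ♭ g = begin
    □₁ ⌊ g ⌋ ∘ δ♭ _                    ≈˘⟨ ⌊⌋-natʳ (□₁ ⌊ g ⌋) _ ⟩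
    ⌊ □₁ (□₁ ⌊ g ⌋) ∘ δ _ ∘ unit _ ⌋   ≈⟨ ⌊⌋-resp-≈ (pullˡ (≈-sym (δ-nat ⌊ g ⌋))) ⟩
    ⌊ (δ _ ∘ □₁ ⌊ g ⌋) ∘ unit _ ⌋      ≈⟨ ⌊⌋-resp-≈ assoc ⟩
    ⌊ δ _ ∘ □₁ ⌊ g ⌋ ∘ unit _ ⌋        ≈⟨ ⌊⌋-resp-≈ (refl⟩∘⟨ □⌊⌋∘unit g) ⟩
    ⌊ δ _ ∘ g ⌋                        ∎

  δ♭-coassoc : ∀ X → □₁ (δ♭ X) ∘ δ♭ X ≈ δ _ ∘ δ♭ X
  δ♭-coassoc X = begin
    □₁ (δ♭ X) ∘ δ♭ X               ≈⟨ □⌊⌋∘δ♭ _ ⟩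
    ⌊ δ _ ∘ δ _ ∘ unit X ⌋         ≈⟨ ⌊⌋-resp-≈ (pullˡ (assoc-cm _)) ⟩
    ⌊ (□₁ (δ _) ∘ δ _) ∘ unit X ⌋  ≈⟨ ⌊⌋-resp-≈ assoc ⟩
    ⌊ □₁ (δ _) ∘ δ _ ∘ unit X ⌋    ≈⟨ ⌊⌋-natʳ (δ _) _ ⟩
    δ _ ∘ δ♭ X                     ∎

  μ-natural : ∀ {X Y} (f : X ⇒ Y) → μ Y ∘ ◇₁ (◇₁ f) ≈ ◇₁ f ∘ μ X
  μ-natural f = begin
    ⌊ δ♭ _ ⌋ ∘ ◇₁ (◇₁ f)      ≈⟨ ⌊⌋-natˡ (δ♭ _) (◇₁ f) ⟩
    ⌊ δ♭ _ ∘ ◇₁ f ⌋           ≈⟨ ⌊⌋-resp-≈ (δ♭-natural f) ⟩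
    ⌊ □₁ (◇₁ f) ∘ δ♭ _ ⌋      ≈⟨ ⌊⌋-natʳ (◇₁ f) (δ♭ _) ⟩
    ◇₁ f ∘ ⌊ δ♭ _ ⌋           ∎

  μ-identityˡ : ∀ X → μ X ∘ η (◇₀ X) ≈ id
  μ-identityˡ X = begin
    ⌊ δ♭ X ⌋ ∘ η _                         ≈⟨ ⌊⌋∘η (δ♭ X) ⟩
    ε _ ∘ δ♭ X                             ≈˘⟨ ⌊⌋-natʳ (ε _) _ ⟩
    ⌊ □₁ (ε _) ∘ δ _ ∘ unit X ⌋            ≈⟨ ⌊⌋-resp-≈ (cancelˡ (identityʳ-cm _)) ⟩
    ⌊ unit X ⌋                             ≈⟨ zig X ⟩
    id                                     ∎

  μ-assoc : ∀ X → μ X ∘ μ (◇₀ X) ≈ μ X ∘ ◇₁ (μ X)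
  μ-assoc X = begin
    μ X ∘ ⌊ δ♭ (◇₀ X) ⌋        ≈˘⟨ ⌊⌋-natʳ (μ X) _ ⟩
    ⌊ □₁ (μ X) ∘ δ♭ (◇₀ X) ⌋   ≈⟨ ⌊⌋-resp-≈ (□⌊⌋∘δ♭ (δ♭ X)) ⟩
    ⌊ ⌊ δ _ ∘ δ♭ X ⌋ ⌋         ≈˘⟨ ⌊⌋-resp-≈ (⌊⌋-resp-≈ (δ♭-coassoc X)) ⟩
    ⌊ ⌊ □₁ (δ♭ X) ∘ δ♭ X ⌋ ⌋   ≈⟨ ⌊⌋-resp-≈ (⌊⌋-natʳ (δ♭ X) (δ♭ X)) ⟩
    ⌊ δ♭ X ∘ μ X ⌋             ≈˘⟨ ⌊⌋-natˡ (δ♭ X) (μ X) ⟩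
    μ X ∘ ◇₁ (μ X)             ∎

  -- l (Γ ,•) X is definitionally extend (l Γ X).
  extend : ∀ {X Y} → X ⇒ ◇₀ Y → ◇₀ X ⇒ ◇₀ Y
  extend f = μ _ ∘ ◇₁ f

  extend-resp-≈ : ∀ {X Y} {f g : X ⇒ ◇₀ Y} → f ≈ g → extend f ≈ extend g
  extend-resp-≈ p = refl⟩∘⟨ ◇-resp-≈ p

  extend-∘ : ∀ {W X Y} (f : X ⇒ ◇₀ Y) (g : W ⇒ X) → extend (f ∘ g) ≈ extend f ∘ ◇₁ g
  extend-∘ f g = ≈-trans (refl⟩∘⟨ ◇-homomorphism) sym-assoc

  extend∘η : ∀ {X Y} (f : X ⇒ ◇₀ Y) → extend f ∘ η X ≈ f
  extend∘η f = begin
    (μ _ ∘ ◇₁ f) ∘ η _   ≈⟨ assoc ⟩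
    μ _ ∘ ◇₁ f ∘ η _     ≈˘⟨ refl⟩∘⟨ η-natural f ⟩
    μ _ ∘ η _ ∘ f        ≈⟨ cancelˡ (μ-identityˡ _) ⟩
    f                    ∎

  extend-extend : ∀ {X Y} (f : X ⇒ ◇₀ Y) → extend (extend f) ≈ extend f ∘ μ X
  extend-extend f = begin
    μ _ ∘ ◇₁ (μ _ ∘ ◇₁ f)        ≈⟨ refl⟩∘⟨ ◇-homomorphism ⟩
    μ _ ∘ ◇₁ (μ _) ∘ ◇₁ (◇₁ f)   ≈˘⟨ pushˡ (μ-assoc _) ⟩
    (μ _ ∘ μ _) ∘ ◇₁ (◇₁ f)      ≈⟨ assoc ⟩
    μ _ ∘ μ _ ∘ ◇₁ (◇₁ f)        ≈⟨ refl⟩∘⟨ μ-natural f ⟩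
    μ _ ∘ ◇₁ f ∘ μ _             ≈⟨ sym-assoc ⟩
    extend f ∘ μ _               ∎

  extend-assoc : ∀ {W X Y} (f : X ⇒ ◇₀ Y) (g : W ⇒ ◇₀ X) →
                 extend (extend f ∘ g) ≈ extend f ∘ extend g
  extend-assoc f g = begin
    extend (extend f ∘ g)       ≈⟨ extend-∘ (extend f) g ⟩
    extend (extend f) ∘ ◇₁ g    ≈⟨ extend-extend f ⟩∘⟨refl ⟩
    (extend f ∘ μ _) ∘ ◇₁ g     ≈⟨ assoc ⟩
    extend f ∘ extend g         ∎

  coe∘coe-sym : ∀ {A B} (p : A ≡ B) → coe p ∘ coe (sym p) ≈ id
  coe∘coe-sym refl = identityˡ

  coe-trans : ∀ {A B D} (p : A ≡ B) (q : B ≡ D) → coe (trans p q) ≈ coe q ∘ coe p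
  coe-trans refl refl = ≈-sym identityˡ

  π₁∘coe : ∀ {A B} T (p : A ≡ B) → π₁ ∘ coe (cong (_× T) p) ≈ coe p ∘ π₁
  π₁∘coe T refl = ≈-trans identityʳ (≈-sym identityˡ)

  coe-◇ : ∀ {A B} (p : A ≡ B) → coe (cong ◇₀ p) ≈ ◇₁ (coe p)
  coe-◇ refl = ≈-sym ◇-identity

  l-natural : ∀ Δ {X Y} (f : X ⇒ Y) → ◇₁ f ∘ l Δ X ≈ l Δ Y ∘ ⟦ Δ ⟧₁ f
  l-natural ∅ f = ≈-sym (η-natural f)
  l-natural (Δ , x ∶ A) f = begin
    ◇₁ f ∘ l Δ _ ∘ π₁            ≈⟨ pullˡ (l-natural Δ f) ⟩
    (l Δ _ ∘ ⟦ Δ ⟧₁ f) ∘ π₁      ≈⟨ assoc ⟩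
    l Δ _ ∘ ⟦ Δ ⟧₁ f ∘ π₁        ≈˘⟨ refl⟩∘⟨ project₁ ⟩
    l Δ _ ∘ π₁ ∘ ⟦ Δ , x ∶ A ⟧₁ f ≈⟨ sym-assoc ⟩
    (l Δ _ ∘ π₁) ∘ ⟦ Δ , x ∶ A ⟧₁ f ∎
  l-natural (Δ ,•) f = begin
    ◇₁ f ∘ μ _ ∘ ◇₁ (l Δ _)                ≈˘⟨ pushˡ (μ-natural f) ⟩
    (μ _ ∘ ◇₁ (◇₁ f)) ∘ ◇₁ (l Δ _)         ≈⟨ assoc ⟩
    μ _ ∘ ◇₁ (◇₁ f) ∘ ◇₁ (l Δ _)           ≈˘⟨ refl⟩∘⟨ ◇-homomorphism ⟩
    μ _ ∘ ◇₁ (◇₁ f ∘ l Δ _)                ≈⟨ extend-resp-≈ (l-natural Δ f) ⟩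
    extend (l Δ _ ∘ ⟦ Δ ⟧₁ f)              ≈⟨ extend-∘ (l Δ _) (⟦ Δ ⟧₁ f) ⟩
    extend (l Δ _) ∘ ◇₁ (⟦ Δ ⟧₁ f)         ∎

  l-coe : ∀ Δ {X Y} (p : X ≡ Y) → l Δ Y ∘ coe (cong ⟦ Δ ⟧₀ p) ≈ ◇₁ (coe p) ∘ l Δ X
  l-coe Δ refl = ≈-trans identityʳ (≈-trans (≈-sym identityˡ) (≈-sym ◇-identity ⟩∘⟨refl))

  l-++ : ∀ Γ Δ X → l (Γ ++ Δ) X ≈ l (Γ ,•) X ∘ l Δ (⟦ Γ ⟧₀ X) ∘ coe (++-⟦⟧₀ Γ Δ X)
  l-++ Γ ∅ X = begin
    l Γ X                          ≈˘⟨ extend∘η (l Γ X) ⟩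
    extend (l Γ X) ∘ η _           ≈˘⟨ refl⟩∘⟨ identityʳ ⟩
    extend (l Γ X) ∘ η _ ∘ id      ∎
  l-++ Γ (Δ , x ∶ A) X = begin
    l (Γ ++ Δ) X ∘ π₁                                 ≈⟨ pushˡ (l-++ Γ Δ X) ⟩
    extend (l Γ X) ∘ (l Δ _ ∘ coe q) ∘ π₁              ≈⟨ refl⟩∘⟨ assoc ⟩
    extend (l Γ X) ∘ l Δ _ ∘ coe q ∘ π₁                ≈˘⟨ refl⟩∘⟨ refl⟩∘⟨ π₁∘coe ⟦ A ⟧ty q ⟩
    extend (l Γ X) ∘ l Δ _ ∘ π₁ ∘ coe (cong (_× ⟦ A ⟧ty) q) ≈⟨ refl⟩∘⟨ sym-assoc ⟩
    extend (l Γ X) ∘ (l Δ _ ∘ π₁) ∘ coe (cong (_× ⟦ A ⟧ty) q) ∎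
    where q = ++-⟦⟧₀ Γ Δ X
  l-++ Γ (Δ ,•) X = begin
    extend (l (Γ ++ Δ) X)                              ≈⟨ extend-resp-≈ (l-++ Γ Δ X) ⟩
    extend (extend (l Γ X) ∘ l Δ _ ∘ coe q)            ≈⟨ extend-assoc (l Γ X) _ ⟩
    extend (l Γ X) ∘ extend (l Δ _ ∘ coe q)            ≈⟨ refl⟩∘⟨ extend-∘ (l Δ _) (coe q) ⟩
    extend (l Γ X) ∘ extend (l Δ _) ∘ ◇₁ (coe q)       ≈˘⟨ refl⟩∘⟨ refl⟩∘⟨ coe-◇ q ⟩
    extend (l Γ X) ∘ extend (l Δ _) ∘ coe (cong ◇₀ q)  ∎
    where q = ++-⟦⟧₀ Γ Δ X

  l-split : ∀ Γ₂ Γ₃ Γ₄ X →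
            l (Γ₂ ++ Γ₃ ++ Γ₄) X
              ≈ l (Γ₂ ,• ++ Γ₄) X
                ∘ coe (sym (++-⟦⟧₀ (Γ₂ ,•) Γ₄ X))
                ∘ ⟦ Γ₄ ⟧₁ (l Γ₃ (⟦ Γ₂ ⟧₀ X))
                ∘ coe (trans (++-⟦⟧₀ (Γ₂ ++ Γ₃) Γ₄ X) (cong ⟦ Γ₄ ⟧₀ (++-⟦⟧₀ Γ₂ Γ₃ X)))
  l-split Γ₂ Γ₃ Γ₄ X = ≈-trans via-Γ₂++Γ₃ (≈-sym via-Γ₂•)
    where
    a = ++-⟦⟧₀ (Γ₂ ++ Γ₃) Γ₄ X
    b = ++-⟦⟧₀ (Γ₂ ,•) Γ₄ X
    r = ++-⟦⟧₀ Γ₂ Γ₃ X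
    l₃ = l Γ₃ (⟦ Γ₂ ⟧₀ X)

    via-Γ₂++Γ₃ : l (Γ₂ ++ Γ₃ ++ Γ₄) X
                   ≈ extend (l (Γ₂ ,•) X) ∘ ◇₁ (l₃ ∘ coe r) ∘ l Γ₄ _ ∘ coe a
    via-Γ₂++Γ₃ = begin
      l (Γ₂ ++ Γ₃ ++ Γ₄) X                                   ≈⟨ l-++ (Γ₂ ++ Γ₃) Γ₄ X ⟩
      extend (l (Γ₂ ++ Γ₃) X) ∘ l Γ₄ _ ∘ coe a                ≈⟨ extend-resp-≈ (l-++ Γ₂ Γ₃ X) ⟩∘⟨refl ⟩
      extend (l (Γ₂ ,•) X ∘ l₃ ∘ coe r) ∘ l Γ₄ _ ∘ coe a      ≈⟨ pushˡ (extend-∘ (l (Γ₂ ,•) X) _) ⟩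
      extend (l (Γ₂ ,•) X) ∘ ◇₁ (l₃ ∘ coe r) ∘ l Γ₄ _ ∘ coe a ∎

    via-Γ₂• : l (Γ₂ ,• ++ Γ₄) X ∘ coe (sym b) ∘ ⟦ Γ₄ ⟧₁ l₃ ∘ coe (trans a (cong ⟦ Γ₄ ⟧₀ r))
                ≈ extend (l (Γ₂ ,•) X) ∘ ◇₁ (l₃ ∘ coe r) ∘ l Γ₄ _ ∘ coe a
    via-Γ₂• = begin
      l (Γ₂ ,• ++ Γ₄) X ∘ coe (sym b) ∘ ⟦ Γ₄ ⟧₁ l₃ ∘ coe (trans a (cong ⟦ Γ₄ ⟧₀ r))
        ≈⟨ l-++ (Γ₂ ,•) Γ₄ X ⟩∘⟨ (refl⟩∘⟨ refl⟩∘⟨ coe-trans a _) ⟩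
      (extend (l (Γ₂ ,•) X) ∘ l Γ₄ _ ∘ coe b) ∘ coe (sym b) ∘ ⟦ Γ₄ ⟧₁ l₃ ∘ coe (cong ⟦ Γ₄ ⟧₀ r) ∘ coe a
        ≈⟨ ≈-trans assoc (refl⟩∘⟨ assoc) ⟩
      extend (l (Γ₂ ,•) X) ∘ l Γ₄ _ ∘ coe b ∘ coe (sym b) ∘ ⟦ Γ₄ ⟧₁ l₃ ∘ coe (cong ⟦ Γ₄ ⟧₀ r) ∘ coe a
        ≈⟨ refl⟩∘⟨ refl⟩∘⟨ cancelˡ (coe∘coe-sym b) ⟩
      extend (l (Γ₂ ,•) X) ∘ l Γ₄ _ ∘ ⟦ Γ₄ ⟧₁ l₃ ∘ coe (cong ⟦ Γ₄ ⟧₀ r) ∘ coe a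
        ≈˘⟨ refl⟩∘⟨ square-∘ʳ (l-natural Γ₄ l₃) ⟩
      extend (l (Γ₂ ,•) X) ∘ ◇₁ l₃ ∘ l Γ₄ _ ∘ coe (cong ⟦ Γ₄ ⟧₀ r) ∘ coe a
        ≈⟨ refl⟩∘⟨ refl⟩∘⟨ square-∘ʳ (l-coe Γ₄ r) ⟩
      extend (l (Γ₂ ,•) X) ∘ ◇₁ l₃ ∘ ◇₁ (coe r) ∘ l Γ₄ _ ∘ coe a
        ≈˘⟨ refl⟩∘⟨ pushˡ ◇-homomorphism ⟩
      extend (l (Γ₂ ,•) X) ∘ ◇₁ (l₃ ∘ coe r) ∘ l Γ₄ _ ∘ coe a
        ∎

lemma5 : ∀ {o ℓ e : Level} (S : Setting o ℓ e)
           (⟦atom⟧ : ℕ → Category.Obj (Setting.C S))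
           (Γ₁ Γ₂ Γ₃ Γ₄ : Ctx) →
           WellFormed (Γ₁ ++ Γ₂ ++ Γ₃ ++ Γ₄) →
           let open Category (Setting.C S)
               open Interp S ⟦atom⟧
           in l (Γ₂ ++ Γ₃ ++ Γ₄) ⟦ Γ₁ ⟧
                ≈ l (Γ₂ ,• ++ Γ₄) ⟦ Γ₁ ⟧
                  ∘ coe (sym (++-⟦⟧₀ (Γ₂ ,•) Γ₄ ⟦ Γ₁ ⟧))
                  ∘ ⟦ Γ₄ ⟧₁ (l Γ₃ (⟦ Γ₂ ⟧₀ ⟦ Γ₁ ⟧))
                  ∘ coe (trans (++-⟦⟧₀ (Γ₂ ++ Γ₃) Γ₄ ⟦ Γ₁ ⟧)
                             (cong ⟦ Γ₄ ⟧₀ (++-⟦⟧₀ Γ₂ Γ₃ ⟦ Γ₁ ⟧)))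
lemma5 S ⟦atom⟧ Γ₁ Γ₂ Γ₃ Γ₄ _ = LockReplacement.l-split S ⟦atom⟧ Γ₂ Γ₃ Γ₄ (Interp.⟦_⟧ S ⟦atom⟧ Γ₁)
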